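{- Let $n\ge 2$ and $1\le k\le n-1$, and let $u=\{u_1,\dots,u_k\}$ and $v=\{v_1,\dots,v_k\}$ be vertices of $F_k(P_n)$ with $u_1<\dots<u_k$ and $v_1<\dots<v_k$. Then the graph distance between $u$ and $v$ in $F_k(P_n)$ is $d(u,v)=\sum_{i=1}^k|v_i-u_i|$.
   Context: $P_n$ is the path graph on $\{1,\dots,n\}$ with edges $\{i,i+1\}$, $1\le i\le n-1$. The $k$-token graph $F_k(P_n)$ has as vertices all $k$-element subsets of $\{1,\dots,n\}$, two being adjacent iff their symmetric difference is an edge of $P_n$. -}

module Defs where

open import Data.Nat using (ℕ; zero; suc; _+_; _≤_; _<_; ∣_-_∣)
open import Data.Bool using (Bool; true; false)
open import Data.Fin using (Fin; toℕ)
open import Data.Fin.Subset using (Subset; ∣_∣)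
open import Data.Vec using (Vec; []; _∷_; lookup)
open import Data.List using (List; []; _∷_; zipWith)
open import Data.Nat.ListAction using (sum)
open import Data.Product using (Σ; _×_)
open import Data.Sum using (_⊎_)
open import Relation.Binary.PropositionalEquality using (_≡_; _≢_)

-- Vertices of F_k(P_n): subsets u of {1,…,n} (encoded as Subset n, position j : Fin n
-- standing for the vertex toℕ j + 1 of P_n) with ∣ u ∣ ≡ k.

-- Adjacency in F_k(P_n): the symmetric difference of u and v is exactly
-- the edge {i+1, i+2} of P_n (0-based positions i, i+1 with i+1 < n).
TokenAdj : {n : ℕ} → Subset n → Subset n → Set
TokenAdj {n} u v =
  Σ ℕ λ i → (suc i < n) ×
    ((j : Fin n) →
      ((lookup u j ≢ lookup v j) → (toℕ j ≡ i ⊎ toℕ j ≡ suc i)) ×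
      ((toℕ j ≡ i ⊎ toℕ j ≡ suc i) → lookup u j ≢ lookup v j))

data Walk {n : ℕ} (k : ℕ) : Subset n → Subset n → ℕ → Set where
  here : (u : Subset n) → ∣ u ∣ ≡ k → Walk k u u 0
  step : {u w v : Subset n} {m : ℕ} → ∣ u ∣ ≡ k → TokenAdj u w →
         Walk k w v m → Walk k u v (suc m)

IsDistance : {n : ℕ} (k : ℕ) → Subset n → Subset n → ℕ → Set
IsDistance {n} k u v d =
  Walk k u v d × ((m : ℕ) → Walk k u v m → d ≤ m)

elemsFrom : {m : ℕ} → ℕ → Vec Bool m → List ℕ
elemsFrom o [] = []
elemsFrom o (true ∷ s) = o ∷ elemsFrom (suc o) s
elemsFrom o (false ∷ s) = elemsFrom (suc o) s

sortedElems : {n : ℕ} → Subset n → List ℕ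
sortedElems = elemsFrom 1

tokenSum : {n : ℕ} → Subset n → Subset n → ℕ
tokenSum u v = sum (zipWith (λ a b → ∣ b - a ∣) (sortedElems u) (sortedElems v))

-- An adjacent move shifts one token by one place without letting two tokens pass each
-- other, so it changes exactly one entry of the sorted list u_1 < … < u_k, by one; hence
-- it changes ∑ |v_i - u_i| by at most one, and every walk from u to v is at least that long.
-- Conversely, at the first position where u and v differ, the first token of one side
-- lies strictly before its partner on the other side; moving that partner one step back
-- towards it lowers the sum by exactly one, so a walk of exactly that length exists.
module Submission where

open import Defs
open import Data.Nat using (ℕ; _≤_; _∸_)
open import Data.Fin.Subset using (Subset; ∣_∣)
open import Relation.Binary.PropositionalEquality using (_≡_)

open import Data.Nat using (zero; suc; _+_; _<_; ∣_-_∣; z≤n; s≤s)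
open import Data.Nat.Properties
  using (∣-∣-triangle; ∣-∣-comm; ∣n-n∣≡0; +-comm; +-suc; +-monoˡ-≤; +-monoʳ-≤;
         ≤-refl; ≤-trans; n≤1+n; suc-injective; m+1+n≢n)
open import Data.Bool using (Bool; true; false)
open import Data.Bool.Properties using (_≟_)
open import Data.Fin using (Fin; toℕ) renaming (zero to fzero; suc to fsuc)
open import Data.Vec using ([]; _∷_; lookup)
open import Data.Vec.Properties using (≡-dec; tabulate∘lookup; tabulate-cong)
open import Data.List using (List; []; _∷_; zipWith)
open import Data.Nat.ListAction using (sum)
open import Data.Product using (Σ; _×_; _,_; proj₁; proj₂)
open import Data.Sum using (_⊎_; inj₁; inj₂) renaming (map to ⊎-map)
open import Relation.Nullary using (yes; no; contradiction)
open import Relation.Binary.PropositionalEquality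
  using (_≢_; refl; sym; trans; cong; subst; module ≡-Reasoning)

∣n-1+n∣≡1 : ∀ n → ∣ n - suc n ∣ ≡ 1
∣n-1+n∣≡1 zero    = refl
∣n-1+n∣≡1 (suc n) = ∣n-1+n∣≡1 n

∣z-x∣≤1+∣z-y∣ : ∀ z x y → ∣ x - y ∣ ≡ 1 → ∣ z - x ∣ ≤ suc ∣ z - y ∣
∣z-x∣≤1+∣z-y∣ z x y ∣x-y∣≡1 = subst (∣ z - x ∣ ≤_) eq (∣-∣-triangle z y x)
  where
  open ≡-Reasoning
  eq : ∣ z - y ∣ + ∣ y - x ∣ ≡ suc ∣ z - y ∣
  eq = begin
    ∣ z - y ∣ + ∣ y - x ∣ ≡⟨ cong (∣ z - y ∣ +_) (trans (∣-∣-comm y x) ∣x-y∣≡1) ⟩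
    ∣ z - y ∣ + 1         ≡⟨ +-comm ∣ z - y ∣ 1 ⟩
    suc ∣ z - y ∣         ∎

∣1+n-m∣≡1+∣n-m∣ : ∀ {m n} → m ≤ n → ∣ suc n - m ∣ ≡ suc ∣ n - m ∣
∣1+n-m∣≡1+∣n-m∣ {n = zero}  z≤n       = refl
∣1+n-m∣≡1+∣n-m∣ {n = suc n} z≤n       = refl
∣1+n-m∣≡1+∣n-m∣             (s≤s m≤n) = ∣1+n-m∣≡1+∣n-m∣ m≤n

∣x∷p∣≡∣x∷q∣⇒∣p∣≡∣q∣ : ∀ {n} x (p q : Subset n) → ∣ x ∷ p ∣ ≡ ∣ x ∷ q ∣ → ∣ p ∣ ≡ ∣ q ∣
∣x∷p∣≡∣x∷q∣⇒∣p∣≡∣q∣ true  _ _ = suc-injective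
∣x∷p∣≡∣x∷q∣⇒∣p∣≡∣q∣ false _ _ = λ eq → eq

∣p∣≡∣q∣⇒∣x∷p∣≡∣x∷q∣ : ∀ {n} x (p q : Subset n) → ∣ p ∣ ≡ ∣ q ∣ → ∣ x ∷ p ∣ ≡ ∣ x ∷ q ∣
∣p∣≡∣q∣⇒∣x∷p∣≡∣x∷q∣ true  _ _ = cong suc
∣p∣≡∣q∣⇒∣x∷p∣≡∣x∷q∣ false _ _ = λ eq → eq

data Step : {n : ℕ} → Subset n → Subset n → Set where
  there     : ∀ {n} {u w : Subset n} x → Step u w → Step (x ∷ u) (x ∷ w)
  moveRight : ∀ {n} (r : Subset n) → Step (true ∷ false ∷ r) (false ∷ true ∷ r)
  moveLeft  : ∀ {n} (r : Subset n) → Step (false ∷ true ∷ r) (true ∷ false ∷ r)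

Step-sym : ∀ {n} {u w : Subset n} → Step u w → Step w u
Step-sym (there x s)   = there x (Step-sym s)
Step-sym (moveRight r) = moveLeft r
Step-sym (moveLeft r)  = moveRight r

Step⇒∣∣≡ : ∀ {n} {u w : Subset n} → Step u w → ∣ w ∣ ≡ ∣ u ∣
Step⇒∣∣≡ (there {u = u} {w} x s) = ∣p∣≡∣q∣⇒∣x∷p∣≡∣x∷q∣ x w u (Step⇒∣∣≡ s)
Step⇒∣∣≡ (moveRight r)          = refl
Step⇒∣∣≡ (moveLeft r)           = refl

DiffersExactlyAt : {n : ℕ} → ℕ → Subset n → Subset n → Set
DiffersExactlyAt {n} i u v =
  (j : Fin n) →
    ((lookup u j ≢ lookup v j) → (toℕ j ≡ i ⊎ toℕ j ≡ suc i)) ×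
    ((toℕ j ≡ i ⊎ toℕ j ≡ suc i) → lookup u j ≢ lookup v j)

DiffersExactlyAt-there⁺ : ∀ {n i x} {u w : Subset n} →
  DiffersExactlyAt i u w → DiffersExactlyAt (suc i) (x ∷ u) (x ∷ w)
DiffersExactlyAt-there⁺ d fzero    = (λ x≢x → contradiction refl x≢x) , λ { (inj₁ ()) ; (inj₂ ()) }
DiffersExactlyAt-there⁺ d (fsuc j) =
  (λ ne → ⊎-map (cong suc) (cong suc) (proj₁ (d j) ne)) ,
  (λ at → proj₂ (d j) (⊎-map suc-injective suc-injective at))

DiffersExactlyAt-there⁻ : ∀ {n i x y} {u w : Subset n} →
  DiffersExactlyAt (suc i) (x ∷ u) (y ∷ w) → x ≡ y × DiffersExactlyAt i u w
DiffersExactlyAt-there⁻ {i = i} {x} {y} {u} {w} d = head , tail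
  where
  head : x ≡ y
  head with x ≟ y
  ... | yes x≡y = x≡y
  ... | no x≢y with proj₁ (d fzero) x≢y
  ...   | inj₁ ()
  ...   | inj₂ ()
  tail : DiffersExactlyAt i u w
  tail j = (λ ne → ⊎-map suc-injective suc-injective (proj₁ (d (fsuc j)) ne)) ,
           (λ at → proj₂ (d (fsuc j)) (⊎-map (cong suc) (cong suc) at))

DiffersExactlyAt-zero⁺ : ∀ {n x x' y y'} {r : Subset n} →
  x ≢ x' → y ≢ y' → DiffersExactlyAt 0 (x ∷ y ∷ r) (x' ∷ y' ∷ r)
DiffersExactlyAt-zero⁺ x≢x' y≢y' fzero        = (λ _ → inj₁ refl) , λ _ → x≢x'
DiffersExactlyAt-zero⁺ x≢x' y≢y' (fsuc fzero) = (λ _ → inj₂ refl) , λ _ → y≢y'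
DiffersExactlyAt-zero⁺ x≢x' y≢y' (fsuc (fsuc j)) =
  (λ ne → contradiction refl ne) , λ { (inj₁ ()) ; (inj₂ ()) }

DiffersExactlyAt-zero⁻ : ∀ {n x x' y y'} {r r' : Subset n} →
  DiffersExactlyAt 0 (x ∷ y ∷ r) (x' ∷ y' ∷ r') → x ≢ x' × y ≢ y' × r ≡ r'
DiffersExactlyAt-zero⁻ {r = r} {r'} d =
  proj₂ (d fzero) (inj₁ refl) , proj₂ (d (fsuc fzero)) (inj₂ refl) , tail
  where
  agree : ∀ j → lookup r j ≡ lookup r' j
  agree j with lookup r j ≟ lookup r' j
  ... | yes eq = eq
  ... | no ne with proj₁ (d (fsuc (fsuc j))) ne
  ...   | inj₁ ()
  ...   | inj₂ ()
  tail : r ≡ r'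
  tail = trans (sym (tabulate∘lookup r)) (trans (tabulate-cong agree) (tabulate∘lookup r'))

Step⇒TokenAdj : ∀ {n} {u w : Subset n} → Step u w → TokenAdj u w
Step⇒TokenAdj (there x s) with Step⇒TokenAdj s
... | i , i+1<n , d = suc i , s≤s i+1<n , DiffersExactlyAt-there⁺ d
Step⇒TokenAdj (moveRight r) = 0 , s≤s (s≤s z≤n) , DiffersExactlyAt-zero⁺ (λ ()) (λ ())
Step⇒TokenAdj (moveLeft r)  = 0 , s≤s (s≤s z≤n) , DiffersExactlyAt-zero⁺ (λ ()) (λ ())

flipBoth⇒Step : ∀ {n x x' y y'} {r : Subset n} → x ≢ x' → y ≢ y' →
  ∣ x ∷ y ∷ r ∣ ≡ ∣ x' ∷ y' ∷ r ∣ → Step (x ∷ y ∷ r) (x' ∷ y' ∷ r)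
flipBoth⇒Step {x = true}  {x' = true}                     x≢x' _ _ = contradiction refl x≢x'
flipBoth⇒Step {x = false} {x' = false}                    x≢x' _ _ = contradiction refl x≢x'
flipBoth⇒Step {y = true}  {y' = true}                     _ y≢y' _ = contradiction refl y≢y'
flipBoth⇒Step {y = false} {y' = false}                    _ y≢y' _ = contradiction refl y≢y'
flipBoth⇒Step {x = true}  {false} {y = false} {y' = true} _ _ _    = moveRight _
flipBoth⇒Step {x = false} {true}  {y = true} {y' = false} _ _ _    = moveLeft _
flipBoth⇒Step {x = true}  {false} {y = true} {y' = false} _ _ eq   = contradiction eq (m+1+n≢n 1)
flipBoth⇒Step {x = false} {true}  {y = false} {y' = true} _ _ eq   = contradiction (sym eq) (m+1+n≢n 1)

DiffersExactlyAt⇒Step : ∀ {n} i {u w : Subset n} → suc i < n →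
  DiffersExactlyAt i u w → ∣ u ∣ ≡ ∣ w ∣ → Step u w
DiffersExactlyAt⇒Step zero {_ ∷ []} {_ ∷ []} (s≤s ()) _ _
DiffersExactlyAt⇒Step zero {x ∷ y ∷ r} {x' ∷ y' ∷ r'} _ d eq
  with DiffersExactlyAt-zero⁻ d
... | x≢x' , y≢y' , refl = flipBoth⇒Step x≢x' y≢y' eq
DiffersExactlyAt⇒Step (suc i) {x ∷ u} {y ∷ w} (s≤s i+1<n) d eq
  with DiffersExactlyAt-there⁻ d
... | refl , d' = there x (DiffersExactlyAt⇒Step i i+1<n d' (∣x∷p∣≡∣x∷q∣⇒∣p∣≡∣q∣ x u w eq))

TokenAdj⇒Step : ∀ {n} {u w : Subset n} → ∣ u ∣ ≡ ∣ w ∣ → TokenAdj u w → Step u w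
TokenAdj⇒Step eq (i , i+1<n , d) = DiffersExactlyAt⇒Step i i+1<n d eq

displacement : List ℕ → List ℕ → ℕ
displacement as bs = sum (zipWith (λ a b → ∣ b - a ∣) as bs)

displacementFrom : ∀ {n} → ℕ → Subset n → Subset n → ℕ
displacementFrom o u v = displacement (elemsFrom o u) (elemsFrom o v)

displacement-self : ∀ as → displacement as as ≡ 0
displacement-self []       = refl
displacement-self (a ∷ as) = trans (cong (_+ displacement as as) (∣n-n∣≡0 a)) (displacement-self as)

displacement-comm : ∀ as bs → displacement as bs ≡ displacement bs as
displacement-comm []       []       = refl
displacement-comm []       (b ∷ bs) = refl
displacement-comm (a ∷ as) []       = refl
displacement-comm (a ∷ as) (b ∷ bs) rewrite ∣-∣-comm b a | displacement-comm as bs = refl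

displacementFrom-comm : ∀ {n} o (u v : Subset n) → displacementFrom o u v ≡ displacementFrom o v u
displacementFrom-comm o u v = displacement-comm (elemsFrom o u) (elemsFrom o v)

displacementFrom-there : ∀ {n} o x (u v : Subset n) →
  displacementFrom o (x ∷ u) (x ∷ v) ≡ displacementFrom (suc o) u v
displacementFrom-there o true  u v = cong (_+ displacementFrom (suc o) u v) (∣n-n∣≡0 o)
displacementFrom-there o false u v = refl

displacement-Step-≤ : ∀ {n} {u w : Subset n} → Step u w → ∀ o bs →
  displacement (elemsFrom o u) bs ≤ suc (displacement (elemsFrom o w) bs)
displacement-Step-≤ (there false s) o bs = displacement-Step-≤ s (suc o) bs
displacement-Step-≤ (there true s) o [] = z≤n
displacement-Step-≤ (there {u = u} {w} true s) o (b ∷ bs) =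
  subst (∣ b - o ∣ + displacement (elemsFrom (suc o) u) bs ≤_)
        (+-suc ∣ b - o ∣ _)
        (+-monoʳ-≤ ∣ b - o ∣ (displacement-Step-≤ s (suc o) bs))
displacement-Step-≤ (moveRight r) o [] = z≤n
displacement-Step-≤ (moveRight r) o (b ∷ bs) =
  +-monoˡ-≤ _ (∣z-x∣≤1+∣z-y∣ b o (suc o) (∣n-1+n∣≡1 o))
displacement-Step-≤ (moveLeft r) o [] = z≤n
displacement-Step-≤ (moveLeft r) o (b ∷ bs) =
  +-monoˡ-≤ _ (∣z-x∣≤1+∣z-y∣ b (suc o) o (trans (∣-∣-comm (suc o) o) (∣n-1+n∣≡1 o)))

Walk⇒∣∣≡ : ∀ {n k} {u v : Subset n} {m} → Walk k u v m → ∣ u ∣ ≡ k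
Walk⇒∣∣≡ (here u ∣u∣≡k)   = ∣u∣≡k
Walk⇒∣∣≡ (step ∣u∣≡k _ _) = ∣u∣≡k

Walk⇒tokenSum≤ : ∀ {n k} {u v : Subset n} {m} → Walk k u v m → tokenSum u v ≤ m
Walk⇒tokenSum≤ (here u _) = subst (_≤ 0) (sym (displacement-self (sortedElems u))) z≤n
Walk⇒tokenSum≤ {u = u} {v} (step {w = w} ∣u∣≡k adj rest) =
  ≤-trans (displacement-Step-≤ u→w 1 (sortedElems v)) (s≤s (Walk⇒tokenSum≤ rest))
  where
  u→w : Step u w
  u→w = TokenAdj⇒Step (trans ∣u∣≡k (sym (Walk⇒∣∣≡ rest))) adj

Walk-snoc : ∀ {n k} {u w v : Subset n} {m} →
  Walk k u w m → ∣ v ∣ ≡ k → TokenAdj w v → Walk k u v (suc m)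
Walk-snoc (here u ∣u∣≡k)        ∣v∣≡k adj = step ∣u∣≡k adj (here _ ∣v∣≡k)
Walk-snoc (step ∣u∣≡k adj' rest) ∣v∣≡k adj = step ∣u∣≡k adj' (Walk-snoc rest ∣v∣≡k adj)

firstToken-moveLeft : ∀ {n} o (v : Subset n) → 0 < ∣ v ∣ →
  Σ (Subset (suc n)) λ v' → Step (false ∷ v) v' ×
    Σ ℕ λ p → Σ (List ℕ) λ t →
      elemsFrom (suc o) v ≡ suc p ∷ t × elemsFrom o v' ≡ p ∷ t × o ≤ p
firstToken-moveLeft o (true ∷ r) _ = true ∷ false ∷ r , moveLeft r , o , _ , refl , refl , ≤-refl
firstToken-moveLeft o (false ∷ r) 0<∣r∣ with firstToken-moveLeft (suc o) r 0<∣r∣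
... | v' , s , p , t , before , after , 1+o≤p =
  false ∷ v' , there false s , p , t , before , after , ≤-trans (n≤1+n o) 1+o≤p

data Closer {n} (o : ℕ) (u v : Subset n) : Set where
  stepFrom : ∀ {w} → Step u w → displacementFrom o u v ≡ suc (displacementFrom o w v) → Closer o u v
  stepTo   : ∀ {w} → Step v w → displacementFrom o u v ≡ suc (displacementFrom o u w) → Closer o u v

Closer-sym : ∀ {n o} {u v : Subset n} → Closer o u v → Closer o v u
Closer-sym {o = o} {u} {v} (stepFrom {w} s eq) =
  stepTo s (trans (displacementFrom-comm o v u) (trans eq (cong suc (displacementFrom-comm o w v))))
Closer-sym {o = o} {u} {v} (stepTo {w} s eq) =
  stepFrom s (trans (displacementFrom-comm o v u) (trans eq (cong suc (displacementFrom-comm o u w))))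

Closer-there : ∀ {n o} x {u v : Subset n} → Closer (suc o) u v → Closer o (x ∷ u) (x ∷ v)
Closer-there {o = o} x {u} {v} (stepFrom {w} s eq) = stepFrom (there x s)
  (trans (displacementFrom-there o x u v) (trans eq (cong suc (sym (displacementFrom-there o x w v)))))
Closer-there {o = o} x {u} {v} (stepTo {w} s eq) = stepTo (there x s)
  (trans (displacementFrom-there o x u v) (trans eq (cong suc (sym (displacementFrom-there o x u w)))))

Closer-firstToken : ∀ {n} o (u v : Subset n) → 0 < ∣ v ∣ → Closer o (true ∷ u) (false ∷ v)
Closer-firstToken o u v 0<∣v∣ with firstToken-moveLeft o v 0<∣v∣
... | v' , s , p , t , before , after , o≤p = stepTo s eq
  where
  eq : displacementFrom o (true ∷ u) (false ∷ v) ≡ suc (displacementFrom o (true ∷ u) v')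
  eq rewrite before | after | ∣1+n-m∣≡1+∣n-m∣ o≤p = refl

closer : ∀ {n} o {u v : Subset n} → u ≢ v → ∣ u ∣ ≡ ∣ v ∣ → Closer o u v
closer o {[]}    {[]}    u≢v _ = contradiction refl u≢v
closer o {x ∷ u} {y ∷ v} u≢v eq with x ≟ y
... | yes refl = Closer-there x (closer (suc o) (λ u≡v → u≢v (cong (x ∷_) u≡v)) (∣x∷p∣≡∣x∷q∣⇒∣p∣≡∣q∣ x u v eq))
closer o {true ∷ u}  {true ∷ v}  _ _  | no x≢y = contradiction refl x≢y
closer o {false ∷ u} {false ∷ v} _ _  | no x≢y = contradiction refl x≢y
closer o {true ∷ u}  {false ∷ v} _ eq | no _   = Closer-firstToken o u v (subst (0 <_) eq (s≤s z≤n))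
closer o {false ∷ u} {true ∷ v}  _ eq | no _   =
  Closer-sym (Closer-firstToken o v u (subst (0 <_) (sym eq) (s≤s z≤n)))

walkOfLength : ∀ {n k} d (u v : Subset n) → ∣ u ∣ ≡ k → ∣ v ∣ ≡ k → tokenSum u v ≡ d → Walk k u v d
walkOfLength {k = k} d u v ∣u∣≡k ∣v∣≡k sum≡d with ≡-dec _≟_ u v
... | yes refl = subst (Walk k u u) (trans (sym (displacement-self (sortedElems u))) sum≡d) (here u ∣u∣≡k)
... | no u≢v with closer 1 u≢v (trans ∣u∣≡k (sym ∣v∣≡k)) | d
...   | stepFrom s eq | zero  = contradiction (trans (sym eq) sum≡d) λ ()
...   | stepTo s eq   | zero  = contradiction (trans (sym eq) sum≡d) λ ()
...   | stepFrom {w} s eq | suc d' = step ∣u∣≡k (Step⇒TokenAdj s)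
        (walkOfLength d' w v (trans (Step⇒∣∣≡ s) ∣u∣≡k) ∣v∣≡k (suc-injective (trans (sym eq) sum≡d)))
...   | stepTo {w} s eq   | suc d' = Walk-snoc
        (walkOfLength d' u w ∣u∣≡k (trans (Step⇒∣∣≡ s) ∣v∣≡k) (suc-injective (trans (sym eq) sum≡d)))
        ∣v∣≡k (Step⇒TokenAdj (Step-sym s))

-- The bounds on n and k only exclude degenerate token graphs; the formula holds regardless.
mainTheorem11 : (n k : ℕ) → 2 ≤ n → 1 ≤ k → k ≤ n ∸ 1 →
    (u v : Subset n) → ∣ u ∣ ≡ k → ∣ v ∣ ≡ k →
    IsDistance k u v (tokenSum u v)
mainTheorem11 n k _ _ _ u v ∣u∣≡k ∣v∣≡k =
  walkOfLength (tokenSum u v) u v ∣u∣≡k ∣v∣≡k refl , λ _ → Walk⇒tokenSum≤
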